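{- Suppose $T$ is a countable first-order theory with the finite model property. Then there is an infinite class $\mathcal{C}$ of finite structures such that $T\subseteq T_{\mathcal{C}}$.
   Context: A first-order theory $T$ has the finite model property if every sentence $\varphi$ with $T\models\varphi$ has a finite model. The (logical) limit theory $T_{\mathcal{C}}$ of a class $\mathcal{C}$ of finite structures is the set of all first-order sentences $\varphi$ such that $\{\mathbf{M}\in\mathcal{C}:\mathbf{M}\not\models\varphi\}$ is finite. -}

module Defs where

open import Data.Nat using (ℕ; suc; _<_)
open import Data.Fin using (Fin)
open import Data.Vec using (Vec; []; _∷_)
open import Data.Vec.Functional as VF using ()
open import Data.Maybe using (Maybe; just)
open import Data.Product using (Σ; ∃; _×_; _,_)
open import Data.Sum using (_⊎_)
open import Data.Empty using (⊥)
open import Relation.Nullary using (¬_)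
open import Relation.Binary.PropositionalEquality using (_≡_)
open import Function.Bundles using (_↔_)

record Signature : Set₁ where
  field
    Func : ℕ → Set
    Rel  : ℕ → Set
open Signature

data Term (L : Signature) (n : ℕ) : Set where
  var : Fin n → Term L n
  app : ∀ {k} → Func L k → Vec (Term L n) k → Term L n

data Formula (L : Signature) : ℕ → Set where
  ⊥f   : ∀ {n} → Formula L n
  _≐_  : ∀ {n} → Term L n → Term L n → Formula L n
  rel  : ∀ {n k} → Rel L k → Vec (Term L n) k → Formula L n
  _⇒_  : ∀ {n} → Formula L n → Formula L n → Formula L n
  _∧f_ : ∀ {n} → Formula L n → Formula L n → Formula L n
  _∨f_ : ∀ {n} → Formula L n → Formula L n → Formula L n
  all  : ∀ {n} → Formula L (suc n) → Formula L n
  ex   : ∀ {n} → Formula L (suc n) → Formula L n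

Sentence : Signature → Set
Sentence L = Formula L 0

Theory : Signature → Set₁
Theory L = Sentence L → Set

-- L-structures (nonempty carrier, as usual in first-order logic).
record Structure (L : Signature) : Set₁ where
  field
    Carrier : Set
    point   : Carrier
    func    : ∀ {k} → Func L k → Vec Carrier k → Carrier
    relI    : ∀ {k} → Rel L k → Vec Carrier k → Set
open Structure

module _ {L : Signature} (M : Structure L) where
  mutual
    evalTerm : ∀ {n} → (Fin n → Carrier M) → Term L n → Carrier M
    evalTerm ρ (var x)    = ρ x
    evalTerm ρ (app f ts) = func M f (evalTerms ρ ts)

    evalTerms : ∀ {n k} → (Fin n → Carrier M) → Vec (Term L n) k → Vec (Carrier M) k
    evalTerms ρ []       = []
    evalTerms ρ (t ∷ ts) = evalTerm ρ t ∷ evalTerms ρ ts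

  Sat : ∀ {n} → (Fin n → Carrier M) → Formula L n → Set
  Sat ρ ⊥f        = ⊥
  Sat ρ (s ≐ t)   = evalTerm ρ s ≡ evalTerm ρ t
  Sat ρ (rel R ts) = relI M R (evalTerms ρ ts)
  Sat ρ (φ ⇒ ψ)   = Sat ρ φ → Sat ρ ψ
  Sat ρ (φ ∧f ψ)  = Sat ρ φ × Sat ρ ψ
  Sat ρ (φ ∨f ψ)  = Sat ρ φ ⊎ Sat ρ ψ
  Sat ρ (all φ)   = ∀ a → Sat (a VF.∷ ρ) φ
  Sat ρ (ex φ)    = Σ (Carrier M) λ a → Sat (a VF.∷ ρ) φ

_⊨_ : ∀ {L} → Structure L → Sentence L → Set
M ⊨ φ = Sat M VF.[] φ

_⊨Th_ : ∀ {L} → Structure L → Theory L → Set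
M ⊨Th T = ∀ φ → T φ → M ⊨ φ

_⊩_ : ∀ {L} → Theory L → Sentence L → Set₁
_⊩_ {L} T φ = ∀ (M : Structure L) → M ⊨Th T → M ⊨ φ

IsFinite : ∀ {L} → Structure L → Set
IsFinite M = Σ ℕ λ n → Carrier M ↔ Fin n

FiniteStructure : Signature → Set₁
FiniteStructure L = Σ (Structure L) IsFinite

struct : ∀ {L} → FiniteStructure L → Structure L
struct (M , _) = M

HasFiniteModel : ∀ {L} → Sentence L → Set₁
HasFiniteModel {L} φ = Σ (FiniteStructure L) λ M → struct M ⊨ φ

FMP : ∀ {L} → Theory L → Set₁
FMP {L} T = ∀ (φ : Sentence L) → T ⊩ φ → HasFiniteModel φ

-- T is countable: T is exactly the set of sentences listed by some
-- enumeration e : ℕ → Maybe Sentence (the 'nothing' entries allow finite T).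
Countable : ∀ {L} → Theory L → Set
Countable {L} T = Σ (ℕ → Maybe (Sentence L)) λ e →
  ∀ (φ : Sentence L) → (T φ → ∃ λ i → e i ≡ just φ) × ((∃ λ i → e i ≡ just φ) → T φ)

-- An infinite class of finite structures, presented as an ℕ-indexed family.
InfiniteClass : Signature → Set₁
InfiniteClass L = ℕ → FiniteStructure L

-- The logical limit theory T_C: all sentences φ such that
-- { M ∈ C : M ⊭ φ } is finite, i.e. only indices below some bound fail φ.
LimitTheory : ∀ {L} → InfiniteClass L → Theory L
LimitTheory C φ = Σ ℕ λ N → ∀ i → ¬ (struct (C i) ⊨ φ) → i < N

_⊆Th_ : ∀ {L} → Theory L → Theory L → Set
T ⊆Th T' = ∀ φ → T φ → T' φ

{-# OPTIONS --safe #-}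
-- Let ψ₀, ψ₁, … enumerate T. Each finite conjunction ψ₀ ∧ … ∧ ψₙ₋₁ is a
-- consequence of T, so by the finite model property it has a finite model Mₙ.
-- In the class (Mₙ)ₙ the sentence ψᵢ can fail only in M₀, …, Mᵢ, so it lies in
-- the limit theory.
module Submission where

open import Defs
open Structure using (Carrier)
open import Data.Fin using (Fin)
open import Data.Maybe using (Maybe; just; nothing; fromMaybe)
open import Data.Nat using (ℕ; zero; suc; _≤_; _<_)
open import Data.Nat.Properties using (_<?_; ≮⇒≥; m<1+n⇒m<n∨m≡n; m<n⇒m<1+n; n<1+n)
open import Data.Product using (Σ; _,_; proj₁; proj₂)
open import Data.Sum using (inj₁; inj₂)
open import Relation.Nullary.Decidable using (decidable-stable)
open import Relation.Binary.PropositionalEquality using (_≡_; refl; cong; subst)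

module _ {L : Signature} where

  ⊤f : ∀ {m} → Formula L m
  ⊤f = ⊥f ⇒ ⊥f

  ⋀< : ∀ {m} → (ℕ → Formula L m) → ℕ → Formula L m
  ⋀< φ zero    = ⊤f
  ⋀< φ (suc n) = ⋀< φ n ∧f φ n

  module _ (M : Structure L) {m} {ρ : Fin m → Carrier M} {φ : ℕ → Formula L m} where

    ⋀<-intro : ∀ n → (∀ i → i < n → Sat M ρ (φ i)) → Sat M ρ (⋀< φ n)
    ⋀<-intro zero    _   = λ ()
    ⋀<-intro (suc n) sat = ⋀<-intro n (λ i i<n → sat i (m<n⇒m<1+n i<n)) , sat n (n<1+n n)

    ⋀<-elim : ∀ n → Sat M ρ (⋀< φ n) → ∀ i → i < n → Sat M ρ (φ i)
    ⋀<-elim (suc n) (sat-⋀ , sat-φₙ) i i<1+n with m<1+n⇒m<n∨m≡n i<1+n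
    ... | inj₁ i<n  = ⋀<-elim n sat-⋀ i i<n
    ... | inj₂ refl = sat-φₙ

  ⊩-⋀< : ∀ {T : Theory L} {φ : ℕ → Sentence L} n →
    (∀ i → i < n → T ⊩ φ i) → T ⊩ ⋀< φ n
  ⊩-⋀< n T⊩φ M M⊨T = ⋀<-intro M n (λ i i<n → T⊩φ i i<n M M⊨T)

  ⊩-enumerated : ∀ {T : Theory L} (e : ℕ → Maybe (Sentence L)) →
    (∀ i {ψ} → e i ≡ just ψ → T ψ) → ∀ i → T ⊩ fromMaybe ⊤f (e i)
  ⊩-enumerated e e⊆T i M M⊨T with e i in eᵢ≡
  ... | just ψ  = M⊨T ψ (e⊆T i eᵢ≡)
  ... | nothing = λ ()

  FMP⇒eventual-models : ∀ {T : Theory L} → FMP T → (ψ : ℕ → Sentence L) →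
    (∀ i → T ⊩ ψ i) →
    Σ (InfiniteClass L) λ C → ∀ n i → i < n → struct (C n) ⊨ ψ i
  FMP⇒eventual-models fmp ψ T⊩ψ = C , λ n → ⋀<-elim (struct (C n)) n (proj₂ (model n))
    where
    model : ∀ n → HasFiniteModel (⋀< ψ n)
    model n = fmp (⋀< ψ n) (⊩-⋀< n (λ i _ → T⊩ψ i))

    C : InfiniteClass L
    C n = proj₁ (model n)

  eventually⇒LimitTheory : ∀ (C : InfiniteClass L) {φ} N →
    (∀ n → N ≤ n → struct (C n) ⊨ φ) → LimitTheory C φ
  eventually⇒LimitTheory C N sat =
    N , λ n ⊭φ → decidable-stable (n <? N) (λ n≮N → ⊭φ (sat n (≮⇒≥ n≮N)))

lemma4p4 : (L : Signature) (T : Theory L) → Countable T → FMP T →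
    Σ (InfiniteClass L) (λ C → T ⊆Th LimitTheory C)
lemma4p4 L T (e , enumerates) fmp = C , T⊆T_C
  where
  ψ : ℕ → Sentence L
  ψ i = fromMaybe ⊤f (e i)

  e⊆T : ∀ i {φ} → e i ≡ just φ → T φ
  e⊆T i eᵢ≡φ = proj₂ (enumerates _) (i , eᵢ≡φ)

  eventual-models : Σ (InfiniteClass L) λ C → ∀ n i → i < n → struct (C n) ⊨ ψ i
  eventual-models = FMP⇒eventual-models fmp ψ (⊩-enumerated e e⊆T)

  C : InfiniteClass L
  C = proj₁ eventual-models

  T⊆T_C : T ⊆Th LimitTheory C
  T⊆T_C φ Tφ with proj₁ (enumerates φ) Tφ
  ... | i , eᵢ≡φ = eventually⇒LimitTheory C {φ} (suc i) λ n i<n →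
    subst (struct (C n) ⊨_) (cong (fromMaybe ⊤f) eᵢ≡φ) (proj₂ eventual-models n i i<n)
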